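{- Let $n\ge 3$ and $d\ge1$, and let $M$ be the canonical Markov chain with states $q_1,\dots,q_{n-2},D,s$ (sink $s$) and transitions: for each $i\in\{1,\dots,n-3\}$, $q_i\to q_{i+1}$ with probability $\frac1{2d}$; $q_{n-2}\to s$ with probability $\frac1{2d}$; each $q_i$ ($1\le i\le n-2$) stays at $q_i$ with probability $\frac12(1-\frac1d)$ and moves to $D$ with probability $\frac12$; $D\to s$ with probability $1$; $s\to s$ with probability $1$. There exists an adaptive algorithm that distinguishes the initial states $q_1$ and $q_2$ in $M$ (outputting the correct one with probability at least $2/3$) using $O(n^2d)$ queries.
   Context: In a canonical Markov chain the only observation of a state $x$ is whether $x=s$; states are hidden. An (adaptive) algorithm interacts with the chain starting from the hidden initial state: at each step it selects, possibly depending on previous observations, a previously generated state and draws a fresh next state from it according to the transition probabilities, independently of all other draws given the selected state; each draw is a query, and it finally outputs its guess for the initial state. -}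

module Defs where

open import Data.Nat using (ℕ; zero; suc; _*_; _⊔_)
open import Data.Fin using (Fin; zero; suc)
open import Data.Bool using (Bool; true; false; if_then_else_)
open import Data.List using (List; []; _∷_)
open import Data.Product using (_×_; _,_)
open import Data.Vec using (Vec; lookup; _∷ʳ_; []; _∷_)
open import Data.Integer using (+_)
open import Data.Rational using (ℚ; _/_; 0ℚ; 1ℚ; ½; _≤_)
  renaming (_+_ to _+ℚ_; _*_ to _*ℚ_; _-_ to _-ℚ_)

-- States of the chain M with m = n - 2 "q" states:
--   q i  (i : Fin m) is q_{i+1},   D,   s (the sink).

data St (m : ℕ) : Set where
  q : Fin m → St m
  D : St m
  s : St m

lift : {m : ℕ} → St m → St (suc m)
lift (q i) = q (suc i)
lift D     = D
lift s     = s

-- q_k (1-based k); by convention q_k := s for k > m = n - 2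
-- (consistent with q_{n-2} → s, i.e. q_{n-1} = s).
qAt : (m k : ℕ) → St m
qAt zero    _             = s
qAt (suc m) zero          = s   -- unused junk (q_0)
qAt (suc m) (suc zero)    = q zero
qAt (suc m) (suc (suc k)) = lift (qAt m (suc k))

nextQ : {m : ℕ} → Fin m → St m
nextQ {suc zero}    zero    = s
nextQ {suc (suc m)} zero    = q (suc zero)
nextQ {suc (suc m)} (suc j) = lift (nextQ {suc m} j)

-- 1/(2d)  (d ≥ 1 is assumed in the statement; value at d = 0 is junk)
inv2d : ℕ → ℚ
inv2d zero    = 0ℚ
inv2d (suc k) = + 1 / (2 * suc k)

step : {m : ℕ} → ℕ → St m → List (St m × ℚ)
step d (q i) = (nextQ i , inv2d d) ∷ (q i , ½ -ℚ inv2d d) ∷ (D , ½) ∷ []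
step d D     = (s , 1ℚ) ∷ []
step d s     = (s , 1ℚ) ∷ []

isSink : {m : ℕ} → St m → Bool
isSink s = true
isSink _ = false

eqSt : {m : ℕ} → St m → St m → Bool
eqSt (q i) (q j) = eqFin i j
  where
  eqFin : {k : ℕ} → Fin k → Fin k → Bool
  eqFin zero    zero    = true
  eqFin (suc a) (suc b) = eqFin a b
  eqFin _       _       = false
eqSt D D = true
eqSt s s = true
eqSt _ _ = false

-- Adaptive (randomized) algorithms as decision trees.
-- Alg A k : the algorithm has generated k states so far (handles Fin k,
-- handle 0 = hidden initial state, handle j = j-th drawn state).
--  * output a    : stop and output guess a
--  * query i f   : draw a fresh successor of the state with handle i;
--                  it becomes handle k; continue with f (whether it is s)
--  * coin p t u  : internal randomness: with probability p continue as t,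
--                  otherwise as u.

data Alg (A : Set) : ℕ → Set where
  output : {k : ℕ} → A → Alg A k
  query  : {k : ℕ} → Fin k → (Bool → Alg A (suc k)) → Alg A k
  coin   : {k : ℕ} → (p : ℚ) → 0ℚ ≤ p → p ≤ 1ℚ → Alg A k → Alg A k → Alg A k

queries : {A : Set} {k : ℕ} → Alg A k → ℕ
queries (output _)     = 0
queries (query _ f)    = suc (queries (f true) ⊔ queries (f false))
queries (coin _ _ _ t u) = queries t ⊔ queries u

-- A full algorithm first observes whether the initial state is s.
Algorithm : ℕ → Set
Algorithm m = Bool → Alg (St m) 1

-- probability that the run outputs x0, given hidden generated states env
succProb : {m k : ℕ} → ℕ → St m → Alg (St m) k → Vec (St m) k → ℚ
succProb d x0 (output g) env = if eqSt g x0 then 1ℚ else 0ℚ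
succProb d x0 (coin p _ _ t u) env =
  p *ℚ succProb d x0 t env +ℚ (1ℚ -ℚ p) *ℚ succProb d x0 u env
succProb {m} {k} d x0 (query i f) env = go (step d (lookup env i))
  where
  go : List (St m × ℚ) → ℚ
  go []             = 0ℚ
  go ((y , p) ∷ ys) = p *ℚ succProb d x0 (f (isSink y)) (env ∷ʳ y) +ℚ go ys

success : {m : ℕ} → ℕ → St m → Algorithm m → ℚ
success d x0 𝒜 = succProb d x0 (𝒜 (isSink x0)) (x0 ∷ [])

-- The algorithm moves a token from the initial state towards s. In one round it draws a
-- successor y of the token and, unless y = s, probes y by drawing one successor of it; the token
-- moves to y only if the probe is not s. As D moves to s surely, this discards the steps into D,
-- so the token advances with probability p = 1/(2d) per round (p(1 - p) from q_{n-3}, whose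
-- genuine step is rejected when the probe from q_{n-2} hits s), and the expected number of rounds
-- from q_i is about 2d(n - 1 - i). The walk is repeated about 200n times from the initial state
-- within a budget of rounds, answering q_2 if all walks finish in time and q_1 otherwise: the
-- expected totals from q_1 and q_2 differ by about 2d per walk, while the variance of the total
-- grows only like d^2 n per walk.
--
-- Chebyshev's inequality is proved along the run: with X = β + (expected remaining rounds)
-- - (remaining fuel) and V a bound on the variance of the remaining rounds, 1 - α(X^2 + V)
-- does not decrease in expectation from one round to the next, is at most the indicator of a
-- correct answer when the run stops, and is at least 2/3 at the start.

module Submission where

open import Defs
open import Data.Nat as ℕ using (ℕ; zero; suc; s≤s; z≤n) renaming (_≤_ to _≤ℕ_)
import Data.Nat.Properties as ℕₚ
open import Data.Nat.Tactic.RingSolver using (solve-∀)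
open import Data.Fin using (Fin; zero; suc; fromℕ; inject₁)
open import Data.Bool using (Bool; true; false; if_then_else_)
open import Data.Vec using (Vec; lookup; _∷ʳ_; []; _∷_)
open import Data.Product using (Σ; ∃-syntax; _×_; _,_)
open import Data.Sum using (inj₁; inj₂)
open import Data.Unit using (tt)
open import Data.Integer as ℤ using (+_)
open import Data.Rational
  using (ℚ; _+_; _*_; _-_; -_; _/_; ½; 0ℚ; 1ℚ; _≤_; toℚᵘ; 1/_; NonZero; Positive; positive; nonNegative)
open import Data.Rational.Properties
import Data.Rational.Unnormalised as ℚᵘ
import Data.Rational.Unnormalised.Properties as ℚᵘₚ
open import Data.Rational.Solver using (module +-*-Solver)
open +-*-Solver using (solve; _:=_; con; _:+_; _:*_; _:-_; :-_)
open import Algebra.Bundles using (CommutativeRing)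
open import Algebra.Properties.Semiring.Mult (CommutativeRing.semiring +-*-commutativeRing)
  using (×-homo-+; ×1-homo-*) renaming (_×_ to _·_)
open import Relation.Binary.PropositionalEquality
open import Relation.Nullary.Decidable using (toWitness)

lookup-∷ʳ-last : ∀ {A : Set} {n} (xs : Vec A n) y → lookup (xs ∷ʳ y) (fromℕ n) ≡ y
lookup-∷ʳ-last []       y = refl
lookup-∷ʳ-last (x ∷ xs) y = lookup-∷ʳ-last xs y

lookup-∷ʳ-inject₁ : ∀ {A : Set} {n} (xs : Vec A n) y i → lookup (xs ∷ʳ y) (inject₁ i) ≡ lookup xs i
lookup-∷ʳ-inject₁ (x ∷ xs) y zero    = refl
lookup-∷ʳ-inject₁ (x ∷ xs) y (suc i) = lookup-∷ʳ-inject₁ xs y i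

qAt-last : ∀ m → qAt m (suc m) ≡ s
qAt-last zero          = refl
qAt-last (suc zero)    = refl
qAt-last (suc (suc m)) = cong lift (qAt-last (suc m))

qAt-step : ∀ m k → 1 ≤ℕ k → k ≤ℕ m → ∃[ j ] (qAt m k ≡ q j × nextQ j ≡ qAt m (suc k))
qAt-step (suc zero)    (suc zero)    _ _         = zero , refl , refl
qAt-step (suc (suc m)) (suc zero)    _ _         = zero , refl , refl
qAt-step (suc zero)    (suc (suc k)) _ (s≤s ())
qAt-step (suc (suc m)) (suc (suc k)) _ (s≤s k<m) with qAt-step (suc m) (suc k) (s≤s z≤n) k<m
... | j , qj , nj = suc j , cong lift qj , cong lift nj

atDistance : (m r : ℕ) → St m
atDistance m r = qAt m (suc m ℕ.∸ r)

atDistance-zero : ∀ m → atDistance m 0 ≡ s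
atDistance-zero = qAt-last

atDistance-suc : ∀ {m} r → suc r ≤ℕ m → ∃[ j ] (atDistance m (suc r) ≡ q j × nextQ j ≡ atDistance m r)
atDistance-suc {m} r r<m with qAt-step m (m ℕ.∸ r) (ℕₚ.m<n⇒0<n∸m r<m) (ℕₚ.m∸n≤m m r)
... | j , qj , nj = j , qj , trans nj (cong (qAt m) (sym (ℕₚ.+-∸-assoc 1 (ℕₚ.<⇒≤ r<m))))

≤-by-slack : ∀ {x y} z → y ≡ x + z → 0ℚ ≤ z → x ≤ y
≤-by-slack {x} z y≡x+z 0≤z = begin
  x       ≡⟨ +-identityʳ x ⟨
  x + 0ℚ  ≤⟨ +-monoʳ-≤ x 0≤z ⟩
  x + z   ≡⟨ y≡x+z ⟨
  _       ∎
  where open ≤-Reasoning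

x≤y⇒0≤y-x : ∀ {x y} → x ≤ y → 0ℚ ≤ y - x
x≤y⇒0≤y-x {x} x≤y = ≤-trans (≤-reflexive (sym (+-inverseʳ x))) (+-monoˡ-≤ (- x) x≤y)

*-monoˡ-≤-0≤ : ∀ {z x y} → 0ℚ ≤ z → x ≤ y → z * x ≤ z * y
*-monoˡ-≤-0≤ {z} 0≤z = *-monoˡ-≤-nonNeg z {{nonNegative 0≤z}}

0≤x*y : ∀ {x y} → 0ℚ ≤ x → 0ℚ ≤ y → 0ℚ ≤ x * y
0≤x*y {x} 0≤x 0≤y = ≤-trans (≤-reflexive (sym (*-zeroʳ x))) (*-monoˡ-≤-0≤ 0≤x 0≤y)

0≤x*x : ∀ x → 0ℚ ≤ x * x
0≤x*x x with ≤-total 0ℚ x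
... | inj₁ 0≤x = 0≤x*y 0≤x 0≤x
... | inj₂ x≤0 = ≤-trans (0≤x*y 0≤-x 0≤-x) (≤-reflexive (solve 1 (λ x → (:- x) :* (:- x) := x :* x) refl x))
  where
  0≤-x : 0ℚ ≤ - x
  0≤-x = neg-antimono-≤ x≤0

square-mono-≤ : ∀ {x y} → 0ℚ ≤ x → x ≤ y → x * x ≤ y * y
square-mono-≤ {x} {y} 0≤x x≤y = ≤-by-slack ((y - x) * (y + x))
  (solve 2 (λ x y → y :* y := x :* x :+ (y :- x) :* (y :+ x)) refl x y)
  (0≤x*y (x≤y⇒0≤y-x x≤y) (+-mono-≤ (≤-trans 0≤x x≤y) 0≤x))

x+k*[y-1]≡x : ∀ x k {y} → y ≡ 1ℚ → x + k * (y - 1ℚ) ≡ x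
x+k*[y-1]≡x x k refl = trans (cong (λ t → x + t) (*-zeroʳ k)) (+-identityʳ x)

ι : ℕ → ℚ
ι n = n · 1ℚ

ι-+ : ∀ m n → ι (m ℕ.+ n) ≡ ι m + ι n
ι-+ = ×-homo-+ 1ℚ

ι-* : ∀ m n → ι (m ℕ.* n) ≡ ι m * ι n
ι-* = ×1-homo-*

0≤ι : ∀ n → 0ℚ ≤ ι n
0≤ι zero    = ≤-refl
0≤ι (suc n) = +-mono-≤ (toWitness {a? = 0ℚ ≤? 1ℚ} tt) (0≤ι n)

ι-mono-≤ : ∀ {m n} → m ≤ℕ n → ι m ≤ ι n
ι-mono-≤ {m} {n} m≤n = ≤-by-slack (ι (n ℕ.∸ m))
  (trans (cong ι (sym (ℕₚ.m+[n∸m]≡n m≤n))) (ι-+ m (n ℕ.∸ m))) (0≤ι (n ℕ.∸ m))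

ι≡/1 : ∀ n → ι n ≡ + n / 1
ι≡/1 zero    = refl
ι≡/1 (suc n) = trans (cong (λ x → 1ℚ + x) (ι≡/1 n)) (toℚᵘ-injective (begin
  toℚᵘ (1ℚ + + n / 1)            ≈⟨ toℚᵘ-homo-+ 1ℚ (+ n / 1) ⟩
  toℚᵘ 1ℚ ℚᵘ.+ toℚᵘ (+ n / 1)    ≈⟨ ℚᵘₚ.+-congʳ (toℚᵘ 1ℚ) (toℚᵘ-fromℚᵘ (ℚᵘ.mkℚᵘ (+ n) 0)) ⟩
  toℚᵘ 1ℚ ℚᵘ.+ ℚᵘ.mkℚᵘ (+ n) 0   ≈⟨ ℚᵘ.*≡* (cross n) ⟩
  ℚᵘ.mkℚᵘ (+ suc n) 0            ≈⟨ toℚᵘ-fromℚᵘ (ℚᵘ.mkℚᵘ (+ suc n) 0) ⟨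
  toℚᵘ (+ suc n / 1)             ∎))
  where
  open ℚᵘₚ.≃-Reasoning
  cross : ∀ n → let 1+n = toℚᵘ 1ℚ ℚᵘ.+ ℚᵘ.mkℚᵘ (+ n) 0 in ℚᵘ.↥ 1+n ℤ.* + 1 ≡ + suc n ℤ.* ℚᵘ.↧ 1+n
  cross zero    = refl
  cross (suc n) = cong (λ k → + suc (suc k)) (ℕₚ.*-identityʳ (n ℕ.* 1))

inv2d-inverse : ∀ e → inv2d (suc e) * ι (2 ℕ.* suc e) ≡ 1ℚ
inv2d-inverse e = trans (cong (inv2d (suc e) *_) (ι≡/1 (2 ℕ.* suc e))) (1/n*n≡1 (e ℕ.+ 1 ℕ.* suc e))
  where
  1/n*n≡1 : ∀ k → + 1 / suc k * (+ suc k / 1) ≡ 1ℚ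
  1/n*n≡1 k = toℚᵘ-injective (begin
    toℚᵘ (+ 1 / suc k * (+ suc k / 1))              ≈⟨ toℚᵘ-homo-* (+ 1 / suc k) (+ suc k / 1) ⟩
    toℚᵘ (+ 1 / suc k) ℚᵘ.* toℚᵘ (+ suc k / 1)      ≈⟨ ℚᵘₚ.*-cong (toℚᵘ-fromℚᵘ (ℚᵘ.mkℚᵘ (+ 1) k))
                                                                   (toℚᵘ-fromℚᵘ (ℚᵘ.mkℚᵘ (+ suc k) 0)) ⟩
    ℚᵘ.mkℚᵘ (+ 1) k ℚᵘ.* ℚᵘ.mkℚᵘ (+ suc k) 0        ≈⟨ ℚᵘ.*≡* (cong (λ n → + suc n) (ℕₚ.*-distribʳ-+ 1 k 0)) ⟩
    toℚᵘ 1ℚ                                          ∎)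
    where open ℚᵘₚ.≃-Reasoning

0≤inv2d : ∀ d → 0ℚ ≤ inv2d d
0≤inv2d zero    = ≤-refl
0≤inv2d (suc e) = nonNegative⁻¹ _ {{normalize-nonNeg 1 (2 ℕ.* suc e)}}

inv2d≤½ : ∀ d → inv2d d ≤ ½
inv2d≤½ zero    = toWitness {a? = 0ℚ ≤? ½} tt
inv2d≤½ (suc e) = ≤-by-slack (½ * p * (Δ - ι 2)) ½≡
  (0≤x*y (0≤x*y (toWitness {a? = 0ℚ ≤? ½} tt) (0≤inv2d (suc e))) (x≤y⇒0≤y-x 2≤Δ))
  where
  p Δ : ℚ
  p = inv2d (suc e)
  Δ = ι (2 ℕ.* suc e)
  2≤Δ : ι 2 ≤ Δ
  2≤Δ = ι-mono-≤ (ℕₚ.m≤m*n 2 (suc e))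
  ½≡ : ½ ≡ p + ½ * p * (Δ - ι 2)
  ½≡ = begin
    ½               ≡⟨ *-identityʳ ½ ⟨
    ½ * 1ℚ          ≡⟨ cong (½ *_) (inv2d-inverse e) ⟨
    ½ * (p * Δ)     ≡⟨ solve 2 (λ p Δ → con ½ :* (p :* Δ) := p :+ con ½ :* p :* (Δ :- con (ι 2))) refl p Δ ⟩
    p + ½ * p * (Δ - ι 2) ∎
    where open ≡-Reasoning

module Run {m : ℕ} (d : ℕ) (x₀ : St m) where

  score : St m → ℚ
  score g = if eqSt g x₀ then 1ℚ else 0ℚ

  S : ∀ {k} → Alg (St m) k → Vec (St m) k → ℚ
  S = succProb d x₀

  mix : ℚ → ℚ → ℚ → ℚ
  mix a b c = inv2d d * a + ((½ - inv2d d) * b + (½ * c + 0ℚ))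

  mix-mono-≤ : ∀ {a a′ b b′ c c′} → a ≤ a′ → b ≤ b′ → c ≤ c′ → mix a b c ≤ mix a′ b′ c′
  mix-mono-≤ a≤ b≤ c≤ =
    +-mono-≤ (*-monoˡ-≤-0≤ (0≤inv2d d) a≤)
      (+-mono-≤ (*-monoˡ-≤-0≤ (x≤y⇒0≤y-x (inv2d≤½ d)) b≤)
        (+-monoˡ-≤ 0ℚ (*-monoˡ-≤-0≤ (toWitness {a? = 0ℚ ≤? ½} tt) c≤)))

  mix-const : ∀ a → mix a a a ≡ a
  mix-const = solve 2 (λ p a → p :* a :+ ((con ½ :- p) :* a :+ (con ½ :* a :+ con 0ℚ)) := a) refl (inv2d d)

  mix-split : ∀ a b → mix a b b ≡ inv2d d * a + (1ℚ - inv2d d) * b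
  mix-split = solve 3 (λ p a b → p :* a :+ ((con ½ :- p) :* b :+ (con ½ :* b :+ con 0ℚ))
                                 := p :* a :+ (con 1ℚ :- p) :* b) refl (inv2d d)

  query-q-≥ : ∀ {k a b c} {env : Vec (St m) k} {h j y} (g : Bool → Alg (St m) (suc k)) →
              lookup env h ≡ q j → nextQ j ≡ y →
              a ≤ S (g (isSink y)) (env ∷ʳ y) →
              b ≤ S (g false) (env ∷ʳ q j) →
              c ≤ S (g false) (env ∷ʳ D) →
              mix a b c ≤ S (query h g) env
  query-q-≥ {env = env} {h} g at-q refl a≤ b≤ c≤ with lookup env h | at-q
  ... | .(q _) | refl = mix-mono-≤ a≤ b≤ c≤

  query-D-≥ : ∀ {k a} {env : Vec (St m) k} {h} (g : Bool → Alg (St m) (suc k)) →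
              lookup env h ≡ D → a ≤ S (g true) (env ∷ʳ s) → a ≤ S (query h g) env
  query-D-≥ {env = env} {h} g at-D a≤ with lookup env h | at-D
  ... | .D | refl = ≤-trans a≤ (≤-reflexive (sym (trans (+-identityʳ _) (*-identityˡ _))))

-- walk f w h: the token is the state with handle h, f rounds of fuel and w restarts are left.
module Walk (m : ℕ) (far near : St m) where

  mutual
    walk : ∀ {k} → ℕ → ℕ → Fin (suc k) → Alg (St m) (suc k)
    walk zero    w h = output far
    walk (suc f) w h = query h (drawn f w h)

    drawn : ∀ {k} → ℕ → ℕ → Fin (suc k) → Bool → Alg (St m) (suc (suc k))
    drawn     f w h true  = arrived f w
    drawn {k} f w h false = query (fromℕ (suc k)) (probed f w h)

    probed : ∀ {k} → ℕ → ℕ → Fin (suc k) → Bool → Alg (St m) (suc (suc (suc k)))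
    probed     f w h true  = walk f w (inject₁ (inject₁ h))
    probed {k} f w h false = walk f w (inject₁ (fromℕ (suc k)))

    arrived : ∀ {k} → ℕ → ℕ → Alg (St m) (suc k)
    arrived f zero    = output near
    arrived f (suc w) = walk f w zero

  queries-walk : ∀ {k} f w (h : Fin (suc k)) → queries (walk f w h) ≤ℕ f ℕ.+ f
  queries-walk zero    w h = z≤n
  queries-walk (suc f) w h = s≤s (ℕₚ.⊔-lub
    (ℕₚ.≤-trans (queries-arrived w) (ℕₚ.+-monoʳ-≤ f (ℕₚ.n≤1+n f)))
    (ℕₚ.≤-trans (s≤s (ℕₚ.⊔-lub (queries-walk f w _) (queries-walk f w _)))
                (ℕₚ.≤-reflexive (sym (ℕₚ.+-suc f f)))))
    where
    queries-arrived : ∀ w → queries (arrived {suc _} f w) ≤ℕ f ℕ.+ f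
    queries-arrived zero    = z≤n
    queries-arrived (suc w) = queries-walk f w zero

-- From distance 2 the token steps to q_{n-2}, whose probe reaches s with probability p.
advanceProb : ℕ → ℕ → ℚ
advanceProb d 2 = inv2d d * (1ℚ - inv2d d)
advanceProb d _ = inv2d d

module WalkBound {m : ℕ} (d : ℕ) (x₀ far near : St m) (r₀ : ℕ) (r₀<m : suc r₀ ≤ℕ m)
  (L : ℕ → ℕ → ℕ → ℚ)
  (restart : ∀ f w → L f (suc w) 0 ≡ L f w (suc r₀))
  (timeout : ∀ w r → L 0 w (suc r) ≤ Run.score d x₀ far)
  (finish : ∀ f → L f 0 0 ≤ Run.score d x₀ near)
  (submartingale : ∀ f w r → L (suc f) w (suc r) ≤
     advanceProb d (suc r) * L f w r + (1ℚ - advanceProb d (suc r)) * L f w (suc r))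
  where

  open Run d x₀
  open Walk m far near

  p : ℚ
  p = inv2d d

  Started : ∀ {k} → Vec (St m) (suc k) → Set
  Started env = lookup env zero ≡ atDistance m (suc r₀)

  started-∷ʳ : ∀ {k} (env : Vec (St m) (suc k)) y → Started env → Started (env ∷ʳ y)
  started-∷ʳ env y started = trans (lookup-∷ʳ-inject₁ env y zero) started

  LowerBound : ℕ → Set
  LowerBound f = ∀ w r {k} (h : Fin (suc k)) (env : Vec (St m) (suc k)) → Started env →
    lookup env h ≡ atDistance m (suc r) → suc r ≤ℕ m → L f w (suc r) ≤ S (walk f w h) env

  -- the value once the drawn successor is at distance r, averaged over its probe
  landed : ℕ → ℕ → ℕ → ℚ
  landed f w 0             = L f w 0
  landed f w 1             = p * L f w 2 + (1ℚ - p) * L f w 1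
  landed f w (suc (suc r)) = L f w (suc (suc r))

  advance-as-mix : ∀ f w r → advanceProb d (suc r) * L f w r + (1ℚ - advanceProb d (suc r)) * L f w (suc r)
                             ≡ mix (landed f w r) (L f w (suc r)) (L f w (suc r))
  advance-as-mix f w 0             = sym (mix-split _ _)
  advance-as-mix f w 1             = solve 3 (λ p a b →
    p :* (con 1ℚ :- p) :* a :+ (con 1ℚ :- p :* (con 1ℚ :- p)) :* b
    := p :* (p :* b :+ (con 1ℚ :- p) :* a) :+ ((con ½ :- p) :* b :+ (con ½ :* b :+ con 0ℚ))) refl p (L f w 1) (L f w 2)
  advance-as-mix f w (suc (suc r)) = sym (mix-split _ _)

  module Round (f : ℕ) (ih : LowerBound f) where

    rejected-≥ : ∀ {w r k} (h : Fin (suc k)) env y z → Started env →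
      lookup env h ≡ atDistance m (suc r) → suc r ≤ℕ m →
      L f w (suc r) ≤ S (probed f w h true) (env ∷ʳ y ∷ʳ z)
    rejected-≥ {w} {r} h env y z started at r<m =
      ih w r (inject₁ (inject₁ h)) (env ∷ʳ y ∷ʳ z) (started-∷ʳ (env ∷ʳ y) z (started-∷ʳ env y started))
        (trans (lookup-∷ʳ-inject₁ (env ∷ʳ y) z (inject₁ h)) (trans (lookup-∷ʳ-inject₁ env y h) at)) r<m

    accepted-≥ : ∀ {w r k} (h : Fin (suc k)) env y z → Started env →
      y ≡ atDistance m (suc r) → suc r ≤ℕ m →
      L f w (suc r) ≤ S (probed f w h false) (env ∷ʳ y ∷ʳ z)
    accepted-≥ {w} {r} {k} h env y z started y-at r<m =
      ih w r (inject₁ (fromℕ (suc k))) (env ∷ʳ y ∷ʳ z) (started-∷ʳ (env ∷ʳ y) z (started-∷ʳ env y started))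
        (trans (lookup-∷ʳ-inject₁ (env ∷ʳ y) z (fromℕ (suc k))) (trans (lookup-∷ʳ-last env y) y-at)) r<m

    probed-≥ : ∀ {w r k} (h : Fin (suc k)) env y z b → Started env →
      lookup env h ≡ atDistance m (suc r) → y ≡ atDistance m (suc r) → suc r ≤ℕ m →
      L f w (suc r) ≤ S (probed f w h b) (env ∷ʳ y ∷ʳ z)
    probed-≥ h env y z true  started at y-at r<m = rejected-≥ h env y z started at r<m
    probed-≥ h env y z false started at y-at r<m = accepted-≥ h env y z started y-at r<m

    arrived-≥ : ∀ w {k} {env : Vec (St m) (suc k)} → Started env → L f w 0 ≤ S (arrived f w) env
    arrived-≥ zero    started = finish f
    arrived-≥ (suc w) started = ≤-trans (≤-reflexive (restart f w)) (ih w r₀ zero _ started started r₀<m)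

    stayed-≥ : ∀ {w r k j} {h : Fin (suc k)} env → Started env →
      lookup env h ≡ atDistance m (suc r) → q j ≡ atDistance m (suc r) → suc r ≤ℕ m →
      L f w (suc r) ≤ S (drawn f w h false) (env ∷ʳ q j)
    stayed-≥ {w} {r} {j = j} {h} env started at qj-at r<m = ≤-trans (≤-reflexive (sym (mix-const _)))
      (query-q-≥ (probed f w h) (lookup-∷ʳ-last env (q j)) refl
        (probed-≥ h env (q j) (nextQ j) (isSink (nextQ j)) started at qj-at r<m)
        (accepted-≥ h env (q j) (q j) started qj-at r<m) (accepted-≥ h env (q j) D started qj-at r<m))

    fell-≥ : ∀ {w r k} {h : Fin (suc k)} env → Started env →
      lookup env h ≡ atDistance m (suc r) → suc r ≤ℕ m →
      L f w (suc r) ≤ S (drawn f w h false) (env ∷ʳ D)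
    fell-≥ {w} {h = h} env started at r<m =
      query-D-≥ (probed f w h) (lookup-∷ʳ-last env D) (rejected-≥ h env D s started at r<m)

    moved-≥ : ∀ w r {k} {h : Fin (suc k)} env → Started env →
      lookup env h ≡ atDistance m (suc r) → suc r ≤ℕ m →
      landed f w r ≤ S (drawn f w h (isSink (atDistance m r))) (env ∷ʳ atDistance m r)
    moved-≥ w zero env started at r<m rewrite atDistance-zero m =
      arrived-≥ w (started-∷ʳ env s started)
    moved-≥ w (suc zero) {h = h} env started at r<m with atDistance-suc 0 (ℕₚ.<⇒≤ r<m)
    ... | j , qj , nj rewrite qj = ≤-trans (≤-reflexive (sym (mix-split _ _)))
      (query-q-≥ (probed f w h) (lookup-∷ʳ-last env (q j)) (trans nj (atDistance-zero m))
        (rejected-≥ h env (q j) s started at r<m)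
        (accepted-≥ h env (q j) (q j) started (sym qj) (ℕₚ.<⇒≤ r<m))
        (accepted-≥ h env (q j) D started (sym qj) (ℕₚ.<⇒≤ r<m)))
    moved-≥ w (suc (suc r)) {h = h} env started at r<m with atDistance-suc (suc r) (ℕₚ.<⇒≤ r<m)
    ... | j , qj , nj with atDistance-suc r (ℕₚ.<⇒≤ (ℕₚ.<⇒≤ r<m))
    ... | j′ , qj′ , _ rewrite qj = ≤-trans (≤-reflexive (sym (mix-const _)))
      (query-q-≥ (probed f w h) (lookup-∷ʳ-last env (q j)) (trans nj qj′)
        (accepted-≥ h env (q j) (q j′) started (sym qj) (ℕₚ.<⇒≤ r<m))
        (accepted-≥ h env (q j) (q j) started (sym qj) (ℕₚ.<⇒≤ r<m))
        (accepted-≥ h env (q j) D started (sym qj) (ℕₚ.<⇒≤ r<m)))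

  walk-≥ : ∀ f → LowerBound f
  walk-≥ zero    w r h env started at r<m = timeout w r
  walk-≥ (suc f) w r h env started at r<m with atDistance-suc r r<m
  ... | j , qj , nj = begin
    L (suc f) w (suc r)
      ≤⟨ submartingale f w r ⟩
    advanceProb d (suc r) * L f w r + (1ℚ - advanceProb d (suc r)) * L f w (suc r)
      ≡⟨ advance-as-mix f w r ⟩
    mix (landed f w r) (L f w (suc r)) (L f w (suc r))
      ≤⟨ query-q-≥ (drawn f w h) (trans at qj) nj
           (moved-≥ w r env started at r<m) (stayed-≥ env started at (sym qj) r<m) (fell-≥ env started at r<m) ⟩
    S (walk (suc f) w h) env ∎
    where
    open ≤-Reasoning
    open Round f (walk-≥ f)

chebyshev : ℚ → ℚ → ℚ → ℚ
chebyshev α X V = 1ℚ - α * (X * X + V)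

chebyshev≤1 : ∀ {α X V} → 0ℚ ≤ α → 0ℚ ≤ V → chebyshev α X V ≤ 1ℚ
chebyshev≤1 {α} {X} {V} 0≤α 0≤V = ≤-by-slack (α * (X * X + V))
  (solve 1 (λ t → con 1ℚ := con 1ℚ :- t :+ t) refl (α * (X * X + V)))
  (0≤x*y 0≤α (+-mono-≤ (0≤x*x X) 0≤V))

chebyshev≤0 : ∀ {α a X V} → 0ℚ ≤ α → α * (a * a) ≡ 1ℚ → 0ℚ ≤ V → a * a ≤ X * X →
              chebyshev α X V ≤ 0ℚ
chebyshev≤0 {α} {a} {X} {V} 0≤α αa²≡1 0≤V a²≤X² = ≤-by-slack (α * (X * X + V) - 1ℚ)
  (solve 1 (λ t → con 0ℚ := con 1ℚ :- t :+ (t :- con 1ℚ)) refl (α * (X * X + V)))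
  (x≤y⇒0≤y-x (begin
    1ℚ              ≡⟨ αa²≡1 ⟨
    α * (a * a)     ≤⟨ *-monoˡ-≤-0≤ 0≤α (≤-trans a²≤X² (≤-by-slack V refl 0≤V)) ⟩
    α * (X * X + V) ∎))
  where open ≤-Reasoning

2/3≤chebyshev : ∀ {α a V} → 0ℚ ≤ α → α * (a * a) ≡ 1ℚ → ι 3 * V ≤ a * a → + 2 / 3 ≤ chebyshev α 0ℚ V
2/3≤chebyshev {α} {a} {V} 0≤α αa²≡1 3V≤a² = ≤-by-slack (+ 1 / 3 - α * V)
  (solve 2 (λ α V → con 1ℚ :- α :* (con 0ℚ :* con 0ℚ :+ V) := con (+ 2 / 3) :+ (con (+ 1 / 3) :- α :* V)) refl α V)
  (x≤y⇒0≤y-x (begin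
    α * V                     ≡⟨ solve 2 (λ α V → α :* V := con (+ 1 / 3) :* (α :* (con (ι 3) :* V))) refl α V ⟩
    + 1 / 3 * (α * (ι 3 * V)) ≤⟨ *-monoˡ-≤-0≤ (toWitness {a? = 0ℚ ≤? + 1 / 3} tt)
                                                (*-monoˡ-≤-0≤ 0≤α 3V≤a²) ⟩
    + 1 / 3 * (α * (a * a))   ≡⟨ cong (+ 1 / 3 *_) αa²≡1 ⟩
    + 1 / 3 * 1ℚ              ≡⟨ *-identityʳ (+ 1 / 3) ⟩
    + 1 / 3                   ∎))
  where open ≤-Reasoning

chebyshev-step : ∀ {P T α} → P * T ≡ 1ℚ → 0ℚ ≤ α → ∀ c M W V →
  chebyshev α (c - 1ℚ + (M + T)) (W + (V + T * T))
    ≤ P * chebyshev α (c + M) (W + V) + (1ℚ - P) * chebyshev α (c + (M + T)) (W + (V + T * T))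
chebyshev-step {P} {T} {α} PT≡1 0≤α c M W V = ≤-by-slack α (begin
  P * chebyshev α (c + M) (W + V) + (1ℚ - P) * chebyshev α (c + (M + T)) (W + (V + T * T))
    ≡⟨ solve 7 (λ α P T c M W V →
         P :* (con 1ℚ :- α :* ((c :+ M) :* (c :+ M) :+ (W :+ V)))
           :+ (con 1ℚ :- P) :* (con 1ℚ :- α :* ((c :+ (M :+ T)) :* (c :+ (M :+ T)) :+ (W :+ (V :+ T :* T))))
         := (con 1ℚ :- α :* ((c :- con 1ℚ :+ (M :+ T)) :* (c :- con 1ℚ :+ (M :+ T)) :+ (W :+ (V :+ T :* T))) :+ α)
           :+ con (ι 2) :* α :* (c :+ M :+ T) :* (P :* T :- con 1ℚ)) refl α P T c M W V ⟩
  chebyshev α (c - 1ℚ + (M + T)) (W + (V + T * T)) + α + ι 2 * α * (c + M + T) * (P * T - 1ℚ)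
    ≡⟨ x+k*[y-1]≡x _ (ι 2 * α * (c + M + T)) PT≡1 ⟩
  chebyshev α (c - 1ℚ + (M + T)) (W + (V + T * T)) + α ∎) 0≤α
  where open ≡-Reasoning

module Timing (e : ℕ) where

  p Δ : ℚ
  p = inv2d (suc e)
  Δ = ι (2 ℕ.* suc e)

  0≤p : 0ℚ ≤ p
  0≤p = 0≤inv2d (suc e)

  0≤½-p : 0ℚ ≤ ½ - p
  0≤½-p = x≤y⇒0≤y-x (inv2d≤½ (suc e))

  2≤Δ : ι 2 ≤ Δ
  2≤Δ = ι-mono-≤ (ℕₚ.m≤m*n 2 (suc e))

  private instance
    p-pos : Positive p
    p-pos = normalize-pos 1 (2 ℕ.* suc e)

    1-p-pos : Positive (1ℚ - p)
    1-p-pos = positive (<-≤-trans (toWitness {a? = 0ℚ <? ½} tt)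
      (≤-by-slack (½ - p) (solve 1 (λ p → con 1ℚ :- p := con ½ :+ (con ½ :- p)) refl p) 0≤½-p))

    p[1-p]-pos : Positive (p * (1ℚ - p))
    p[1-p]-pos = pos*pos⇒pos p (1ℚ - p)

    p[1-p]-nonZero : NonZero (p * (1ℚ - p))
    p[1-p]-nonZero = pos⇒nonZero (p * (1ℚ - p))

  T₂ : ℚ
  T₂ = 1/ (p * (1ℚ - p))

  0≤T₂ : 0ℚ ≤ T₂
  0≤T₂ = nonNegative⁻¹ T₂ {{pos⇒nonNeg T₂ {{1/pos⇒pos (p * (1ℚ - p))}}}}

  ≡-modulo-inverses : ∀ x y a b → x ≡ y + a * (p * Δ - 1ℚ) + b * (p * (1ℚ - p) * T₂ - 1ℚ) → x ≡ y
  ≡-modulo-inverses x y a b x≡ =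
    trans x≡ (trans (x+k*[y-1]≡x _ b (*-inverseʳ (p * (1ℚ - p)))) (x+k*[y-1]≡x y a (inv2d-inverse e)))

  Δ+1≤T₂ : Δ + 1ℚ ≤ T₂
  Δ+1≤T₂ = ≤-by-slack (T₂ * p * p)
    (≡-modulo-inverses T₂ _ (- (T₂ * (1ℚ - p))) (Δ + 1ℚ)
      (solve 3 (λ p Δ T → T := (Δ :+ con 1ℚ) :+ T :* p :* p :+ (:- (T :* (con 1ℚ :- p))) :* (p :* Δ :- con 1ℚ)
                                :+ (Δ :+ con 1ℚ) :* (p :* (con 1ℚ :- p) :* T :- con 1ℚ)) refl p Δ T₂))
    (0≤x*y (0≤x*y 0≤T₂ 0≤p) 0≤p)

  T₂≤Δ+2 : T₂ ≤ Δ + ι 2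
  T₂≤Δ+2 = ≤-by-slack (ι 2 * T₂ * p * (½ - p))
    (≡-modulo-inverses (Δ + ι 2) _ (T₂ * (1ℚ - p) * (1ℚ + ι 2 * p) - ι 2) (- (Δ * (1ℚ + ι 2 * p)))
      (solve 3 (λ p Δ T → Δ :+ con (ι 2) := T :+ con (ι 2) :* T :* p :* (con ½ :- p)
                            :+ (T :* (con 1ℚ :- p) :* (con 1ℚ :+ con (ι 2) :* p) :- con (ι 2)) :* (p :* Δ :- con 1ℚ)
                            :+ (:- (Δ :* (con 1ℚ :+ con (ι 2) :* p))) :* (p :* (con 1ℚ :- p) :* T :- con 1ℚ)) refl p Δ T₂))
    (0≤x*y (0≤x*y (0≤x*y (0≤ι 2) 0≤T₂) 0≤p) 0≤½-p)

  Δ≤Δ+2 : Δ ≤ Δ + ι 2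
  Δ≤Δ+2 = ≤-by-slack (ι 2) refl (0≤ι 2)

  stepTime : ℕ → ℚ
  stepTime 2 = T₂
  stepTime _ = Δ

  advanceProb*stepTime : ∀ r → advanceProb (suc e) r * stepTime r ≡ 1ℚ
  advanceProb*stepTime 0                   = inv2d-inverse e
  advanceProb*stepTime 1                   = inv2d-inverse e
  advanceProb*stepTime 2                   = *-inverseʳ (p * (1ℚ - p))
  advanceProb*stepTime (suc (suc (suc r))) = inv2d-inverse e

  Δ≤stepTime : ∀ r → Δ ≤ stepTime r
  Δ≤stepTime 0                   = ≤-refl
  Δ≤stepTime 1                   = ≤-refl
  Δ≤stepTime 2                   = ≤-trans (≤-by-slack 1ℚ refl (toWitness {a? = 0ℚ ≤? 1ℚ} tt)) Δ+1≤T₂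
  Δ≤stepTime (suc (suc (suc r))) = ≤-refl

  stepTime≤Δ+2 : ∀ r → stepTime r ≤ Δ + ι 2
  stepTime≤Δ+2 0                   = Δ≤Δ+2
  stepTime≤Δ+2 1                   = Δ≤Δ+2
  stepTime≤Δ+2 2                   = T₂≤Δ+2
  stepTime≤Δ+2 (suc (suc (suc r))) = Δ≤Δ+2

  0≤stepTime : ∀ r → 0ℚ ≤ stepTime r
  0≤stepTime r = ≤-trans (0≤ι (2 ℕ.* suc e)) (Δ≤stepTime r)

  meanTime : ℕ → ℚ
  meanTime zero    = 0ℚ
  meanTime (suc r) = meanTime r + stepTime (suc r)

  spread : ℕ → ℚ
  spread zero    = 0ℚ
  spread (suc r) = spread r + stepTime (suc r) * stepTime (suc r)

  0≤meanTime : ∀ r → 0ℚ ≤ meanTime r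
  0≤meanTime zero    = ≤-refl
  0≤meanTime (suc r) = +-mono-≤ (0≤meanTime r) (0≤stepTime (suc r))

  0≤spread : ∀ r → 0ℚ ≤ spread r
  0≤spread zero    = ≤-refl
  0≤spread (suc r) = +-mono-≤ (0≤spread r) (0≤x*x (stepTime (suc r)))

  1≤meanTime : ∀ r → 1ℚ ≤ meanTime (suc r)
  1≤meanTime r = ≤-trans (≤-reflexive (sym (+-identityˡ 1ℚ)))
    (+-mono-≤ (0≤meanTime r) (≤-trans (toWitness {a? = 1ℚ ≤? ι 2} tt) (≤-trans 2≤Δ (Δ≤stepTime (suc r)))))

  meanTime≤ : ∀ r → meanTime (suc r) ≤ Δ * ι (suc r) + ι 2
  meanTime≤ zero          = ≤-by-slack (ι 2)
    (solve 1 (λ Δ → Δ :* (con 1ℚ :+ con 0ℚ) :+ con (ι 2) := con 0ℚ :+ Δ :+ con (ι 2)) refl Δ) (0≤ι 2)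
  meanTime≤ (suc zero)    = ≤-trans (+-monoʳ-≤ (0ℚ + Δ) T₂≤Δ+2) (≤-reflexive
    (solve 1 (λ Δ → con 0ℚ :+ Δ :+ (Δ :+ con (ι 2)) := Δ :* (con 1ℚ :+ (con 1ℚ :+ con 0ℚ)) :+ con (ι 2)) refl Δ))
  meanTime≤ (suc (suc r)) = ≤-trans (+-monoˡ-≤ Δ (meanTime≤ (suc r))) (≤-reflexive
    (solve 2 (λ Δ i → Δ :* i :+ con (ι 2) :+ Δ := Δ :* (con 1ℚ :+ i) :+ con (ι 2)) refl Δ (ι (suc (suc r)))))

  meanTime≥ : ∀ r → Δ * ι (suc (suc r)) + 1ℚ ≤ meanTime (suc (suc r))
  meanTime≥ zero    = ≤-trans (≤-reflexive
    (solve 1 (λ Δ → Δ :* (con 1ℚ :+ (con 1ℚ :+ con 0ℚ)) :+ con 1ℚ := con 0ℚ :+ Δ :+ (Δ :+ con 1ℚ)) refl Δ))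
    (+-monoʳ-≤ (0ℚ + Δ) Δ+1≤T₂)
  meanTime≥ (suc r) = ≤-trans (≤-reflexive
    (solve 2 (λ Δ i → Δ :* (con 1ℚ :+ i) :+ con 1ℚ := Δ :* i :+ con 1ℚ :+ Δ) refl Δ (ι (suc (suc r)))))
    (+-monoˡ-≤ Δ (meanTime≥ r))

  spread≤ : ∀ r → spread r ≤ ι r * ((Δ + ι 2) * (Δ + ι 2))
  spread≤ zero    = ≤-reflexive (sym (*-zeroˡ ((Δ + ι 2) * (Δ + ι 2))))
  spread≤ (suc r) = ≤-trans
    (+-mono-≤ (spread≤ r) (square-mono-≤ (0≤stepTime (suc r)) (stepTime≤Δ+2 (suc r))))
    (≤-reflexive (solve 2 (λ i t → i :* t :+ t := (con 1ℚ :+ i) :* t) refl (ι r) ((Δ + ι 2) * (Δ + ι 2))))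

module Potential (e r₀ : ℕ) (β α : ℚ) where
  open Timing e

  offset : ℕ → ℕ → ℚ
  offset f w = β - ι f + ι w * meanTime r₀

  deviation : ℕ → ℕ → ℕ → ℚ
  deviation f w r = offset f w + meanTime r

  variance : ℕ → ℕ → ℚ
  variance w r = ι w * spread r₀ + spread r

  L : ℕ → ℕ → ℕ → ℚ
  L f w r = chebyshev α (deviation f w r) (variance w r)

  0≤variance : ∀ w r → 0ℚ ≤ variance w r
  0≤variance w r = +-mono-≤ (0≤x*y (0≤ι w) (0≤spread r₀)) (0≤spread r)

  variance-start : ∀ w → variance w r₀ ≡ ι (suc w) * spread r₀
  variance-start w = solve 2 (λ W S → W :* S :+ S := (con 1ℚ :+ W) :* S) refl (ι w) (spread r₀)

  L-restart : ∀ f w → L f (suc w) 0 ≡ L f w r₀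
  L-restart f w = cong₂ (chebyshev α)
    (solve 4 (λ b F W M → b :- F :+ (con 1ℚ :+ W) :* M :+ con 0ℚ := b :- F :+ W :* M :+ M) refl β (ι f) (ι w) (meanTime r₀))
    (solve 2 (λ W S → (con 1ℚ :+ W) :* S :+ con 0ℚ := W :* S :+ S) refl (ι w) (spread r₀))

  L-submartingale : 0ℚ ≤ α → ∀ f w r → L (suc f) w (suc r) ≤
    advanceProb (suc e) (suc r) * L f w r + (1ℚ - advanceProb (suc e) (suc r)) * L f w (suc r)
  L-submartingale 0≤α f w r =
    subst (λ c → chebyshev α (c + meanTime (suc r)) (variance w (suc r)) ≤
                 advanceProb (suc e) (suc r) * L f w r + (1ℚ - advanceProb (suc e) (suc r)) * L f w (suc r))
      (solve 4 (λ b F W M → b :- F :+ W :* M :- con 1ℚ := b :- (con 1ℚ :+ F) :+ W :* M) refl β (ι f) (ι w) (meanTime r₀))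
      (chebyshev-step {advanceProb (suc e) (suc r)} (advanceProb*stepTime (suc r)) 0≤α
        (offset f w) (meanTime r) (ι w * spread r₀) (spread r))

  deviation-start : ∀ F w → β ≡ ι F - ι (suc w) * meanTime r₀ → deviation F w r₀ ≡ 0ℚ
  deviation-start F w refl =
    solve 3 (λ F W M → F :- (con 1ℚ :+ W) :* M :- F :+ W :* M :+ M := con 0ℚ) refl (ι F) (ι w) (meanTime r₀)

  deviation-finish : ∀ {a} → 0ℚ ≤ a → β + a ≤ 0ℚ → ∀ f → a * a ≤ deviation f 0 0 * deviation f 0 0
  deviation-finish {a} 0≤a β+a≤0 f = ≤-trans
    (square-mono-≤ 0≤a (≤-by-slack (ι f + - (β + a))
      (solve 4 (λ b a F M → :- (b :- F :+ con 0ℚ :* M :+ con 0ℚ) := a :+ (F :+ :- (b :+ a))) refl β a (ι f) (meanTime r₀))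
      (+-mono-≤ (0≤ι f) (neg-antimono-≤ β+a≤0))))
    (≤-reflexive (solve 1 (λ x → (:- x) :* (:- x) := x :* x) refl (deviation f 0 0)))

  deviation-timeout : ∀ {a} → 0ℚ ≤ a → a ≤ β + 1ℚ → ∀ w r → a * a ≤ deviation 0 w (suc r) * deviation 0 w (suc r)
  deviation-timeout {a} 0≤a a≤β+1 w r = square-mono-≤ 0≤a (≤-trans a≤β+1
    (≤-by-slack (ι w * meanTime r₀ + (meanTime (suc r) - 1ℚ))
      (solve 4 (λ b W M₀ M → b :- con 0ℚ :+ W :* M₀ :+ M := b :+ con 1ℚ :+ (W :* M₀ :+ (M :- con 1ℚ))) refl
        β (ι w) (meanTime r₀) (meanTime (suc r)))
      (+-mono-≤ (0≤x*y (0≤ι w) (0≤meanTime r₀)) (x≤y⇒0≤y-x (1≤meanTime r)))))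

module Distinguisher (x e : ℕ) where
  open Timing e

  m d : ℕ
  m = suc (suc x)
  d = suc e

  -- fuel is at least margin above walks · meanTime (n - 3) and at least margin below
  -- walks · meanTime (n - 2), and margin² ≥ 3 · walks · spread (n - 2) makes the Chebyshev bound 1/3.
  walks margin fuel : ℕ
  walks  = 192 ℕ.* m
  margin = 96 ℕ.* m ℕ.* suc (2 ℕ.* e)
  fuel   = walks ℕ.* (2 ℕ.* d ℕ.* suc x ℕ.+ 2) ℕ.+ margin

  a : ℚ
  a = ι margin

  0≤a : 0ℚ ≤ a
  0≤a = 0≤ι margin

  private instance
    a-pos : Positive a
    a-pos = positive (<-≤-trans (toWitness {a? = 0ℚ <? 1ℚ} tt) (ι-mono-≤ {1} {margin} (s≤s z≤n)))

    a²-pos : Positive (a * a)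
    a²-pos = pos*pos⇒pos a a

    a²-nonZero : NonZero (a * a)
    a²-nonZero = pos⇒nonZero (a * a)

  α : ℚ
  α = 1/ (a * a)

  0≤α : 0ℚ ≤ α
  0≤α = nonNegative⁻¹ α {{pos⇒nonNeg α {{1/pos⇒pos (a * a)}}}}

  αa²≡1 : α * (a * a) ≡ 1ℚ
  αa²≡1 = *-inverseˡ (a * a)

  open Walk m (q zero) (q (suc zero))

  𝒜 : Algorithm m
  𝒜 _ = walk fuel (ℕ.pred walks) zero

  queries-𝒜 : ∀ b → queries (𝒜 b) ≤ℕ 768 ℕ.* (suc (suc m) ℕ.* suc (suc m) ℕ.* d)
  queries-𝒜 b = ℕₚ.≤-trans (queries-walk fuel (ℕ.pred walks) zero)
    (ℕₚ.≤-trans (ℕₚ.m≤m+n (fuel ℕ.+ fuel) _) (ℕₚ.≤-reflexive (budget x e)))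
    where
    budget : ∀ x e → let m = suc (suc x); walks = 192 ℕ.* m
                         fuel = walks ℕ.* (2 ℕ.* suc e ℕ.* suc x ℕ.+ 2) ℕ.+ 96 ℕ.* m ℕ.* suc (2 ℕ.* e) in
      fuel ℕ.+ fuel ℕ.+ (3456 ℕ.* x ℕ.* e ℕ.+ 2880 ℕ.* x ℕ.+ 9984 ℕ.* e ℕ.+ 8832)
        ≡ 768 ℕ.* (suc (suc m) ℕ.* suc (suc m) ℕ.* suc e)
    budget = solve-∀

  ι-fuel : ι fuel ≡ ι walks * (Δ * ι (suc x) + ι 2) + a
  ι-fuel = begin
    ι fuel
      ≡⟨ ι-+ (walks ℕ.* (2 ℕ.* d ℕ.* suc x ℕ.+ 2)) margin ⟩
    ι (walks ℕ.* (2 ℕ.* d ℕ.* suc x ℕ.+ 2)) + a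
      ≡⟨ cong (_+ a) (ι-* walks (2 ℕ.* d ℕ.* suc x ℕ.+ 2)) ⟩
    ι walks * ι (2 ℕ.* d ℕ.* suc x ℕ.+ 2) + a
      ≡⟨ cong (λ t → ι walks * t + a) (ι-+ (2 ℕ.* d ℕ.* suc x) 2) ⟩
    ι walks * (ι (2 ℕ.* d ℕ.* suc x) + ι 2) + a
      ≡⟨ cong (λ t → ι walks * (t + ι 2) + a) (ι-* (2 ℕ.* d) (suc x)) ⟩
    ι walks * (Δ * ι (suc x) + ι 2) + a
      ∎
    where open ≡-Reasoning

  ι-fuel+margin : ι fuel + a ≡ ι walks * (Δ * ι m + 1ℚ)
  ι-fuel+margin = begin
    ι fuel + a                                 ≡⟨ ι-+ fuel margin ⟨
    ι (fuel ℕ.+ margin)                        ≡⟨ cong ι (balance x e) ⟩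
    ι (walks ℕ.* (2 ℕ.* d ℕ.* m ℕ.+ 1))        ≡⟨ ι-* walks (2 ℕ.* d ℕ.* m ℕ.+ 1) ⟩
    ι walks * ι (2 ℕ.* d ℕ.* m ℕ.+ 1)          ≡⟨ cong (ι walks *_) (ι-+ (2 ℕ.* d ℕ.* m) 1) ⟩
    ι walks * (ι (2 ℕ.* d ℕ.* m) + ι 1)        ≡⟨ cong (λ t → ι walks * (t + ι 1)) (ι-* (2 ℕ.* d) m) ⟩
    ι walks * (Δ * ι m + 1ℚ)                   ∎
    where
    open ≡-Reasoning
    balance : ∀ x e → let m = suc (suc x); walks = 192 ℕ.* m; margin = 96 ℕ.* m ℕ.* suc (2 ℕ.* e) in
      walks ℕ.* (2 ℕ.* suc e ℕ.* suc x ℕ.+ 2) ℕ.+ margin ℕ.+ margin ≡ walks ℕ.* (2 ℕ.* suc e ℕ.* m ℕ.+ 1)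
    balance = solve-∀

  3·walks·spread≤a² : ∀ r → r ≤ℕ m → ι 3 * (ι walks * spread r) ≤ a * a
  3·walks·spread≤a² r r≤m = begin
    ι 3 * (ι walks * spread r)
      ≤⟨ *-monoˡ-≤-0≤ (0≤ι 3) (*-monoˡ-≤-0≤ (0≤ι walks) (spread≤ r)) ⟩
    ι 3 * (ι walks * (ι r * ((Δ + ι 2) * (Δ + ι 2))))
      ≡⟨ cong (λ t → ι 3 * (ι walks * (ι r * (t * t)))) (ι-+ (2 ℕ.* d) 2) ⟨
    ι 3 * (ι walks * (ι r * (ι S * ι S)))
      ≡⟨ cast ⟨
    ι (3 ℕ.* (walks ℕ.* (r ℕ.* (S ℕ.* S))))
      ≤⟨ ι-mono-≤ nat-bound ⟩
    ι (margin ℕ.* margin)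
      ≡⟨ ι-* margin margin ⟩
    a * a
      ∎
    where
    open ≤-Reasoning
    S : ℕ
    S = 2 ℕ.* d ℕ.+ 2
    cast : ι (3 ℕ.* (walks ℕ.* (r ℕ.* (S ℕ.* S)))) ≡ ι 3 * (ι walks * (ι r * (ι S * ι S)))
    cast = trans (ι-* 3 (walks ℕ.* (r ℕ.* (S ℕ.* S)))) (cong (ι 3 *_) (trans (ι-* walks (r ℕ.* (S ℕ.* S)))
             (cong (ι walks *_) (trans (ι-* r (S ℕ.* S)) (cong (ι r *_) (ι-* S S))))))
    square : ∀ x e → let m = suc (suc x) in
      3 ℕ.* (192 ℕ.* m ℕ.* (m ℕ.* ((2 ℕ.* suc e ℕ.+ 2) ℕ.* (2 ℕ.* suc e ℕ.+ 2))))
        ℕ.+ 576 ℕ.* (m ℕ.* m) ℕ.* (e ℕ.* (60 ℕ.* e ℕ.+ 48))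
        ≡ 96 ℕ.* m ℕ.* suc (2 ℕ.* e) ℕ.* (96 ℕ.* m ℕ.* suc (2 ℕ.* e))
    square = solve-∀
    nat-bound : 3 ℕ.* (walks ℕ.* (r ℕ.* (S ℕ.* S))) ≤ℕ margin ℕ.* margin
    nat-bound = ℕₚ.≤-trans (ℕₚ.*-monoʳ-≤ 3 (ℕₚ.*-monoʳ-≤ walks (ℕₚ.*-monoˡ-≤ (S ℕ.* S) r≤m)))
      (ℕₚ.≤-trans (ℕₚ.m≤m+n _ _) (ℕₚ.≤-reflexive (square x e)))

  module Side (r : ℕ) (r<m : suc r ≤ℕ m) where

    β : ℚ
    β = ι fuel - ι walks * meanTime (suc r)

    open Potential e (suc r) β α public

    start : + 2 / 3 ≤ L fuel (ℕ.pred walks) (suc r)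
    start = subst₂ (λ X V → + 2 / 3 ≤ chebyshev α X V)
      (sym (deviation-start fuel (ℕ.pred walks) refl)) (sym (variance-start (ℕ.pred walks)))
      (2/3≤chebyshev {a = a} {V = ι walks * spread (suc r)} 0≤α αa²≡1 (3·walks·spread≤a² (suc r) r<m))

  success-far : + 2 / 3 ≤ success d (q zero) 𝒜
  success-far = ≤-trans start (walk-≥ fuel (ℕ.pred walks) (suc x) zero (q zero ∷ []) q₁-at q₁-at ℕₚ.≤-refl)
    where
    open Side (suc x) ℕₚ.≤-refl
    q₁-at : q zero ≡ atDistance m m
    q₁-at = cong (qAt m) (sym (ℕₚ.m+n∸n≡m 1 m))
    β+a≤0 : β + a ≤ 0ℚ
    β+a≤0 = ≤-by-slack (ι walks * meanTime m - (ι fuel + a))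
      (solve 4 (λ F a K M → con 0ℚ := F :- K :* M :+ a :+ (K :* M :- (F :+ a))) refl (ι fuel) a (ι walks) (meanTime m))
      (x≤y⇒0≤y-x (≤-trans (≤-reflexive ι-fuel+margin) (*-monoˡ-≤-0≤ (0≤ι walks) (meanTime≥ x))))
    open WalkBound d (q zero) (q zero) (q (suc zero)) (suc x) ℕₚ.≤-refl L L-restart
      (λ w r → chebyshev≤1 {X = deviation 0 w (suc r)} 0≤α (0≤variance w (suc r)))
      (λ f → chebyshev≤0 {a = a} {X = deviation f 0 0} 0≤α αa²≡1 (0≤variance 0 0)
               (deviation-finish 0≤a β+a≤0 f))
      (L-submartingale 0≤α)

  success-near : + 2 / 3 ≤ success d (q (suc zero)) 𝒜
  success-near = ≤-trans start (walk-≥ fuel (ℕ.pred walks) x zero (q (suc zero) ∷ []) q₂-at q₂-at (ℕₚ.n≤1+n (suc x)))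
    where
    open Side x (ℕₚ.n≤1+n (suc x))
    q₂-at : q (suc zero) ≡ atDistance m (suc x)
    q₂-at = cong (qAt m) (sym (ℕₚ.m+n∸n≡m 2 x))
    a≤β+1 : a ≤ β + 1ℚ
    a≤β+1 = ≤-by-slack (ι walks * (Δ * ι (suc x) + ι 2) - ι walks * meanTime (suc x) + 1ℚ)
      (trans (cong (λ F → F - ι walks * meanTime (suc x) + 1ℚ) ι-fuel)
        (solve 4 (λ a B K M → B :+ a :- K :* M :+ con 1ℚ := a :+ (B :- K :* M :+ con 1ℚ)) refl
          a (ι walks * (Δ * ι (suc x) + ι 2)) (ι walks) (meanTime (suc x))))
      (+-mono-≤ (x≤y⇒0≤y-x (*-monoˡ-≤-0≤ (0≤ι walks) (meanTime≤ x))) (toWitness {a? = 0ℚ ≤? 1ℚ} tt))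
    open WalkBound d (q (suc zero)) (q zero) (q (suc zero)) x (ℕₚ.n≤1+n (suc x)) L L-restart
      (λ w r → chebyshev≤0 {a = a} {X = deviation 0 w (suc r)} 0≤α αa²≡1 (0≤variance w (suc r))
                 (deviation-timeout 0≤a a≤β+1 w r))
      (λ f → chebyshev≤1 {X = deviation f 0 0} 0≤α (0≤variance 0 0))
      (L-submartingale 0≤α)

-- For n = 3 the statement's q_2 is qAt 1 2 = s, told apart from q_1 by the initial observation.
observeSink : Algorithm 1
observeSink false = output (q zero)
observeSink true  = output s

lemma5p2 : ∃[ C ] ((n d : ℕ) → 3 ≤ℕ n → 1 ≤ℕ d →
    Σ (Algorithm (n ℕ.∸ 2)) (λ 𝒜 →
      (queries (𝒜 false) ≤ℕ C ℕ.* (n ℕ.* n ℕ.* d)) × (queries (𝒜 true) ≤ℕ C ℕ.* (n ℕ.* n ℕ.* d))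
      × (+ 2 / 3 ≤ success d (qAt (n ℕ.∸ 2) 1) 𝒜)
      × (+ 2 / 3 ≤ success d (qAt (n ℕ.∸ 2) 2) 𝒜)))
lemma5p2 = 768 , λ where
  zero                      _       ()                  _
  (suc zero)                _       (s≤s ())            _
  (suc (suc zero))          _       (s≤s (s≤s ()))      _
  (suc (suc (suc _)))       zero    _                   ()
  (suc (suc (suc zero)))    (suc e) _ _ →
    observeSink , z≤n , z≤n , toWitness {a? = + 2 / 3 ≤? 1ℚ} tt , toWitness {a? = + 2 / 3 ≤? 1ℚ} tt
  (suc (suc (suc (suc x)))) (suc e) _ _ →
    let open Distinguisher x e in 𝒜 , queries-𝒜 false , queries-𝒜 true , success-far , success-near
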